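{- The following two statements are equivalent. (i) For every $m,n\ge 1$ and every reduced union-closed matrix $F\in\mathbb{Q}^{m\times n}$, $$2\max\{\Sigma[Fe_k] : k=1,\ldots,n\}\ \ge\ m.$$ (ii) For every $m,n\ge 1$ and every reduced union-closed matrix $F\in\mathbb{Q}^{m\times n}$, there exists $x\in\Delta_n$ such that $2\,\Sigma[Fx]\ge m$.
   Context: A matrix $F\in\mathbb{Q}^{m\times n}$ is a reduced union-closed matrix if all its entries are $0$ or $1$ and: some row is entirely $0$; some row is entirely $1$; all rows are distinct; for every column $k$ there are two rows which differ only in the $k$-th column; and for all rows $h,i$ there is a row $j$ with $F(j,k)=F(h,k)+F(i,k)-F(h,k)F(i,k)$ for all $k$ (the rows are closed under entrywise OR). Equivalently, $F$ is the characteristic matrix ($F(h,k)=1$ iff $x_k\in A_h$) of a reduced union-closed family $\{A_1,\dots,A_m\}$ on $S=\{x_1,\dots,x_n\}$, i.e. a union-closed family containing $\varnothing$ and $S$ such that for every $x\in S$ there are members $A,B$ with $A\setminus B=\{x\}$. Here $e_k$ is the $k$-th unit coordinate vector, $\Sigma v$ denotes the sum of all entries of a vector $v$, and $\Delta_n=\{x\in\mathbb{Q}^n : x_k\ge 0\ (k=1,\dots,n),\ \Sigma x=1\}$. -}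

module Defs where

open import Data.Nat using (ℕ)
open import Data.Fin using (Fin)
open import Data.Product using (Σ; ∃; _×_; _,_)
open import Data.Sum using (_⊎_)
open import Data.Rational using (ℚ; 0ℚ; 1ℚ; _+_; _-_; _*_; _≤_; _⊔_)
import Data.Rational as ℚ
import Data.Fin
import Data.Integer
import Relation.Nullary
open import Data.Vec.Functional using (foldr)
open import Relation.Binary.PropositionalEquality using (_≡_; _≢_)

Matrix : ℕ → ℕ → Set
Matrix m n = Fin m → Fin n → ℚ

Σv : ∀ {n} → (Fin n → ℚ) → ℚ
Σv v = foldr _+_ 0ℚ v

_·_ : ∀ {m n} → Matrix m n → (Fin n → ℚ) → (Fin m → ℚ)
(F · x) h = Σv (λ k → F h k * x k)

e : ∀ {n} → Fin n → Fin n → ℚ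
e k j with Data.Fin._≟_ k j
... | Relation.Nullary.yes _ = 1ℚ
... | Relation.Nullary.no _ = 0ℚ


-- maximum of a vector of rationals (fold with base 0; used only for
-- n ≥ 1 and vectors with nonnegative entries, where it is the true max)
maxv : ∀ {n} → (Fin n → ℚ) → ℚ
maxv v = foldr _⊔_ 0ℚ v

record ReducedUnionClosed {m n : ℕ} (F : Matrix m n) : Set where
  field
    zero-one   : ∀ h k → (F h k ≡ 0ℚ) ⊎ (F h k ≡ 1ℚ)
    zero-row   : ∃ λ h → ∀ k → F h k ≡ 0ℚ
    one-row    : ∃ λ h → ∀ k → F h k ≡ 1ℚ
    distinct   : ∀ h i → h ≢ i → ∃ λ k → F h k ≢ F i k
    separating : ∀ k → ∃ λ h → ∃ λ i →
                   F h k ≢ F i k × (∀ l → l ≢ k → F h l ≡ F i l)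
    union-closed : ∀ h i → ∃ λ j → ∀ k →
                   F j k ≡ F h k + F i k - F h k * F i k

InSimplex : ∀ {n} → (Fin n → ℚ) → Set
InSimplex x = (∀ k → 0ℚ ≤ x k) × (Σv x ≡ 1ℚ)

ℕ→ℚ : ℕ → ℚ
ℕ→ℚ m = Data.Integer.+ m ℚ./ 1

module Submission where

-- Neither direction uses the union-closed structure: the two
-- bounds are equivalent matrix by matrix, for every rational matrix F and
-- every positive threshold t and nonnegative factor a (the theorem takes
-- t = m and a = 2).  Write c k = Σ[F e_k] for the column sums and M = maxv c.
--
--  * (ii) ⇒ (i): by exchanging the order of summation Σ[F x] = Σ_k c k · x k,
--    which for x ∈ Δ_n is a convex combination of the c k, hence at most M.
--  * (i) ⇒ (ii): the fold defining maxv either returns its base value 0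
--    (impossible, since 0 < t ≤ a · M) or one of the c k; in the latter case
--    the vertex e_k of the simplex realises the bound, as Σ[F e_k] = c k.

open import Defs
open import Data.Nat using (ℕ; _≥_; zero; suc)
open import Data.Fin using (Fin; zero; suc; _≟_)
open import Data.Product using (∃; _×_; _,_)
open import Data.Sum using (_⊎_; inj₁; inj₂)
open import Data.Empty using (⊥-elim)
open import Relation.Nullary using (yes; no)
open import Data.Rational using (ℚ; 0ℚ; 1ℚ; _+_; _*_; _≤_; _<_; nonNegative)
open import Data.Rational.Properties
  using ( ≤-refl; ≤-trans; <-≤-trans; <-irrefl; ≤-reflexive; +-identityˡ; +-identityʳ
        ; *-identityˡ; *-identityʳ; *-zeroʳ; *-monoˡ-≤-nonNeg; *-monoʳ-≤-nonNeg; +-mono-≤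
        ; ⊔-sel; p≤p⊔q; p≤q⇒p≤r⊔q; nonNegative⁻¹; positive⁻¹
        ; normalize-pos; normalize-nonNeg; +-*-commutativeRing; module ≤-Reasoning )
open import Algebra.Bundles using (CommutativeRing)
open import Algebra.Properties.Semiring.Sum (CommutativeRing.semiring +-*-commutativeRing)
  using (sum-cong-≗; sum-replicate-zero; ∑-comm; *-distribˡ-sum; *-distribʳ-sum)
open import Relation.Binary.PropositionalEquality using (_≡_; refl; sym; trans; cong; cong₂; subst; module ≡-Reasoning)
open import Function.Bundles using (_⇔_; mk⇔; module Equivalence)

-- Shifting both indices does not change a unit-vector entry (the decision
-- suc k ≟ suc j is computed from k ≟ j); this lets sums against e k be
-- computed by induction on the dimension.
e-suc : ∀ {n} (k j : Fin n) → e (suc k) (suc j) ≡ e k j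
e-suc k j with k ≟ j
... | yes _ = refl
... | no _ = refl

Σv-*e : ∀ {n} (a : Fin n → ℚ) (k : Fin n) → Σv (λ j → a j * e k j) ≡ a k
Σv-*e {suc n} a zero = begin
  a zero * e {suc n} zero zero + Σv (λ j → a (suc j) * e zero (suc j))
    ≡⟨ cong₂ _+_ (*-identityʳ (a zero))
                 (sum-cong-≗ (λ j → *-zeroʳ (a (suc j)))) ⟩
  a zero + Σv {n} (λ _ → 0ℚ)
    ≡⟨ cong (a zero +_) (sum-replicate-zero n) ⟩
  a zero + 0ℚ
    ≡⟨ +-identityʳ (a zero) ⟩
  a zero
  ∎
  where open ≡-Reasoning
Σv-*e a (suc k) = begin
  a zero * e (suc k) zero + Σv (λ j → a (suc j) * e (suc k) (suc j))
    ≡⟨ cong₂ _+_ (*-zeroʳ (a zero))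
                 (sum-cong-≗ (λ j → cong (a (suc j) *_) (e-suc k j))) ⟩
  0ℚ + Σv (λ j → a (suc j) * e k j)
    ≡⟨ +-identityˡ _ ⟩
  Σv (λ j → a (suc j) * e k j)
    ≡⟨ Σv-*e (λ j → a (suc j)) k ⟩
  a (suc k)
  ∎
  where open ≡-Reasoning

e∈Δ : ∀ {n} (k : Fin n) → InSimplex (e k)
e∈Δ k = nonneg , trans (sum-cong-≗ (λ j → sym (*-identityˡ (e k j)))) (Σv-*e (λ _ → 1ℚ) k)
  where
  nonneg : ∀ j → 0ℚ ≤ e k j
  nonneg j with k ≟ j
  ... | yes _ = nonNegative⁻¹ 1ℚ
  ... | no _ = ≤-refl

maxv-upper : ∀ {n} (v : Fin n → ℚ) (k : Fin n) → v k ≤ maxv v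
maxv-upper v zero = p≤p⊔q _ _
maxv-upper v (suc k) = p≤q⇒p≤r⊔q (v zero) (maxv-upper (λ j → v (suc j)) k)

-- Since ⊔ is selective, maxv is either its base value 0 or an entry.
maxv-attained : ∀ {n} (v : Fin n → ℚ) → maxv v ≡ 0ℚ ⊎ ∃ λ k → maxv v ≡ v k
maxv-attained {zero} v = inj₁ refl
maxv-attained {suc n} v with ⊔-sel (v zero) (maxv (λ j → v (suc j)))
... | inj₁ max≡head = inj₂ (zero , max≡head)
... | inj₂ max≡rest with maxv-attained (λ j → v (suc j))
...   | inj₁ rest≡0 = inj₁ (trans max≡rest rest≡0)
...   | inj₂ (k , rest≡vk) = inj₂ (suc k , trans max≡rest rest≡vk)

convex≤maxv : ∀ {n} (c x : Fin n → ℚ) → InSimplex x → Σv (λ k → c k * x k) ≤ maxv c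
convex≤maxv c x (x≥0 , Σx≡1) = begin
  Σv (λ k → c k * x k)
    ≤⟨ Σv-mono (λ k → *-monoʳ-≤-nonNeg (x k) {{nonNegative (x≥0 k)}} (maxv-upper c k)) ⟩
  Σv (λ k → maxv c * x k)
    ≡⟨ sym (*-distribˡ-sum (maxv c) x) ⟩
  maxv c * Σv x
    ≡⟨ cong (maxv c *_) Σx≡1 ⟩
  maxv c * 1ℚ
    ≡⟨ *-identityʳ (maxv c) ⟩
  maxv c
  ∎
  where
  open ≤-Reasoning
  Σv-mono : ∀ {n} {f g : Fin n → ℚ} → (∀ k → f k ≤ g k) → Σv f ≤ Σv g
  Σv-mono {zero} _ = ≤-refl
  Σv-mono {suc n} f≤g = +-mono-≤ (f≤g zero) (Σv-mono (λ k → f≤g (suc k)))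

columnSums : ∀ {m n} → Matrix m n → Fin n → ℚ
columnSums F k = Σv (F · e k)

Σ·≡weighted-columnSums : ∀ {m n} (F : Matrix m n) (x : Fin n → ℚ) →
  Σv (F · x) ≡ Σv (λ k → columnSums F k * x k)
Σ·≡weighted-columnSums F x = begin
  Σv (λ h → Σv (λ k → F h k * x k))
    ≡⟨ ∑-comm (λ h k → F h k * x k) ⟩
  Σv (λ k → Σv (λ h → F h k * x k))
    ≡⟨ sum-cong-≗ (λ k → sym (*-distribʳ-sum (x k) (λ h → F h k))) ⟩
  Σv (λ k → Σv (λ h → F h k) * x k)
    ≡⟨ sum-cong-≗ (λ k → cong (_* x k) (sym (sum-cong-≗ (λ h → Σv-*e (F h) k)))) ⟩
  Σv (λ k → columnSums F k * x k)
  ∎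
  where open ≡-Reasoning

maxColumn⇔simplexPoint : ∀ {m n} (F : Matrix m n) (t a : ℚ) → 0ℚ < t → 0ℚ ≤ a →
  (t ≤ a * maxv (columnSums F)) ⇔ (∃ λ x → InSimplex x × (t ≤ a * Σv (F · x)))
maxColumn⇔simplexPoint F t a 0<t 0≤a = mk⇔ vertex averaging
  where
  vertex : t ≤ a * maxv (columnSums F) → ∃ λ x → InSimplex x × (t ≤ a * Σv (F · x))
  vertex t≤aM with maxv-attained (columnSums F)
  ... | inj₁ M≡0 = ⊥-elim (<-irrefl refl (<-≤-trans 0<t t≤0))
    where
    t≤0 : t ≤ 0ℚ
    t≤0 = ≤-trans (subst (λ M → t ≤ a * M) M≡0 t≤aM) (≤-reflexive (*-zeroʳ a))
  ... | inj₂ (k , M≡ck) = e k , e∈Δ k , subst (λ M → t ≤ a * M) M≡ck t≤aM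

  averaging : (∃ λ x → InSimplex x × (t ≤ a * Σv (F · x))) → t ≤ a * maxv (columnSums F)
  averaging (x , x∈Δ , t≤aΣ) = ≤-trans t≤aΣ (*-monoˡ-≤-nonNeg a {{nonNegative 0≤a}}
    (≤-trans (≤-reflexive (Σ·≡weighted-columnSums F x)) (convex≤maxv (columnSums F) x x∈Δ)))

ℕ→ℚ-pos : ∀ m → m ≥ 1 → 0ℚ < ℕ→ℚ m
ℕ→ℚ-pos (suc m) _ = positive⁻¹ (ℕ→ℚ (suc m)) {{normalize-pos (suc m) 1}}

ℕ→ℚ-nonneg : ∀ m → 0ℚ ≤ ℕ→ℚ m
ℕ→ℚ-nonneg m = nonNegative⁻¹ (ℕ→ℚ m) {{normalize-nonNeg m 1}}

proposition1 :
    (∀ (m n : ℕ) → m ≥ 1 → n ≥ 1 → (F : Matrix m n) → ReducedUnionClosed F →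
       ℕ→ℚ m ≤ ℕ→ℚ 2 * maxv (λ k → Σv (F · e k)))
    ⇔
    (∀ (m n : ℕ) → m ≥ 1 → n ≥ 1 → (F : Matrix m n) → ReducedUnionClosed F →
       ∃ λ (x : Fin n → ℚ) → InSimplex x × (ℕ→ℚ m ≤ ℕ→ℚ 2 * Σv (F · x)))
proposition1 = mk⇔
  (λ columnBound m n m≥1 n≥1 F reduced →
     Equivalence.to (matrixwise m≥1 F) (columnBound m n m≥1 n≥1 F reduced))
  (λ simplexBound m n m≥1 n≥1 F reduced →
     Equivalence.from (matrixwise m≥1 F) (simplexBound m n m≥1 n≥1 F reduced))
  where
  matrixwise : ∀ {m n} → m ≥ 1 → (F : Matrix m n) →
    (ℕ→ℚ m ≤ ℕ→ℚ 2 * maxv (columnSums F))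
      ⇔ (∃ λ x → InSimplex x × (ℕ→ℚ m ≤ ℕ→ℚ 2 * Σv (F · x)))
  matrixwise {m} m≥1 F =
    maxColumn⇔simplexPoint F (ℕ→ℚ m) (ℕ→ℚ 2) (ℕ→ℚ-pos m m≥1) (ℕ→ℚ-nonneg 2)
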